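{- Let $\Delta(x;y)$ be a polynomial in $x_1,\dots,x_n,y_1,\dots,y_n$ that is alternating under the diagonal action of $S_n$, let $D(x;y)$ be a polynomial, and set $\widetilde\Delta=D(\partial_x;\partial_y)\Delta$. Then $\mathbf M_{\widetilde\Delta}$ is a submodule of $\mathbf M_\Delta$ and $D(\partial_x;\partial_y)$ maps $\mathbf M_\Delta$ surjectively onto $\mathbf M_{\widetilde\Delta}$. Letting $\mathbf K$ be the kernel of this map, $$\mathbf M_\Delta\cap\mathbf M_{\widetilde\Delta}^{\perp}=\mathrm{flip}_\Delta^{ -1}\mathbf K,$$ and we have the decompositions (a) $\mathbf M_\Delta=\mathbf M_{\widetilde\Delta}\oplus_\perp\mathrm{flip}_\Delta^{ -1}\mathbf K$ (a direct sum of mutually orthogonal subspaces); (b) $\mathbf M_\Delta=\mathrm{flip}_\Delta\mathbf M_{\widetilde\Delta}\oplus\mathbf K$ (a direct sum).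
   Context: All polynomials have rational coefficients. For polynomials $P,Q$ in $x_1,\dots,x_n,y_1,\dots,y_n$, $\langle P,Q\rangle=P(\partial_x;\partial_y)Q(x;y)|_{x=y=0}$, where $P(\partial_x;\partial_y)$ replaces each $x_i$ by $\partial_{x_i}$ and $y_i$ by $\partial_{y_i}$; $\perp$ denotes orthogonal complement for this scalar product. For a polynomial $F$, $\mathbf M_F$ is the linear span of all partial derivatives of all orders (including order $0$) of $F$. $\mathrm{flip}_\Delta:\mathbf M_\Delta\to\mathbf M_\Delta$ is $P\mapsto P(\partial_x;\partial_y)\Delta$, a linear bijection; $\mathrm{flip}_\Delta^{ -1}$ is its inverse, and for a subspace $\mathbf N\subseteq\mathbf M_\Delta$, $\mathrm{flip}_\Delta\mathbf N=\{P(\partial)\Delta:P\in\mathbf N\}$. The diagonal action of $\sigma\in S_n$ is $\sigma P=P(x_{\sigma_1},\dots,x_{\sigma_n};y_{\sigma_1},\dots,y_{\sigma_n})$. -}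

module Defs where

open import Data.Nat as ℕ using (ℕ; zero; suc; _∸_; _<?_)
open import Data.Nat.Properties as ℕP using ()
open import Data.Integer as ℤ using (+_)
open import Data.Rational as ℚ using (ℚ; 0ℚ; 1ℚ; _+_; _*_; -_; _/_)
open import Data.Rational.Properties as ℚP using ()
open import Data.Fin using (Fin)
open import Data.Fin.Properties as FinP using ()
open import Data.Fin.Permutation using (Permutation′; _⟨$⟩ʳ_; _⟨$⟩ˡ_)
open import Data.Vec as Vec using (Vec; lookup; tabulate; zipWith; replicate)
open import Data.Vec.Properties as VecP using ()
open import Data.List as List using (List; []; _∷_; map; concatMap; allFin; filter; length)
open import Data.Product using (Σ; ∃; _×_; _,_)
open import Data.Product.Properties as ProdP using ()
open import Relation.Binary.PropositionalEquality using (_≡_)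
open import Relation.Nullary using (yes; no; Dec)
open import Relation.Nullary.Decidable using (_×-dec_)

-- A monomial x^α y^β is given by its pair of exponent vectors (α , β).
-- A polynomial is a finite (not necessarily normalised) list of terms
-- c · x^α y^β; two polynomials are equal (≈) when they have the same
-- coefficient at every monomial.

Mono : ℕ → Set
Mono n = Vec ℕ n × Vec ℕ n

Poly : ℕ → Set
Poly n = List (ℚ × Mono n)

module _ {n : ℕ} where

  _≟ₘ_ : (a b : Mono n) → Dec (a ≡ b)
  _≟ₘ_ = ProdP.≡-dec (VecP.≡-dec ℕP._≟_) (VecP.≡-dec ℕP._≟_)

  coeff : Poly n → Mono n → ℚ
  coeff [] m = 0ℚ
  coeff ((c , m′) ∷ P) m with m′ ≟ₘ m
  ... | yes _ = c + coeff P m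
  ... | no  _ = coeff P m

  infix 4 _≈_
  _≈_ : Poly n → Poly n → Set
  P ≈ Q = ∀ m → coeff P m ≡ coeff Q m

  0ₚ : Poly n
  0ₚ = []

  _+ₚ_ : Poly n → Poly n → Poly n
  P +ₚ Q = P List.++ Q

  _·ₚ_ : ℚ → Poly n → Poly n
  c ·ₚ P = map (λ { (d , m) → (c * d , m) }) P

  mono0 : Mono n
  mono0 = replicate n 0 , replicate n 0

  -- falling factorial b (b-1) ... (b-k+1);  ∂ᵏ xᵇ = fall b k · x^(b-k)
  fall : ℕ → ℕ → ℕ
  fall b zero = 1
  fall b (suc k) = b ℕ.* fall (b ∸ 1) k

  prodℕ : ∀ {k} → Vec ℕ k → ℕ
  prodℕ = Vec.foldr _ ℕ._*_ 1

  -- ∂x^α ∂y^β applied to the single term c · x^γ y^δ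
  ∂mono-term : Mono n → ℚ × Mono n → ℚ × Mono n
  ∂mono-term (α , β) (c , (γ , δ)) =
    ( c * ((+ (prodℕ (zipWith fall γ α) ℕ.* prodℕ (zipWith fall δ β))) / 1)
    , (zipWith _∸_ γ α , zipWith _∸_ δ β) )

  ∂mono : Mono n → Poly n → Poly n
  ∂mono m F = map (∂mono-term m) F

  -- P(∂x;∂y) Q
  apply : Poly n → Poly n → Poly n
  apply P Q = concatMap (λ { (c , m) → c ·ₚ ∂mono m Q }) P

  ⟨_,_⟩ : Poly n → Poly n → ℚ
  ⟨ P , Q ⟩ = coeff (apply P Q) mono0

  Subspace : Set₁
  Subspace = Poly n → Set

  M : Poly n → Subspace
  M F Q = ∃ λ (cs : List (ℚ × Mono n)) →
            Q ≈ List.foldr _+ₚ_ 0ₚ (map (λ { (c , m) → c ·ₚ ∂mono m F }) cs)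

  _⊆_ : Subspace → Subspace → Set
  A ⊆ B = ∀ P → A P → B P

  _≐_ : Subspace → Subspace → Set
  A ≐ B = (A ⊆ B) × (B ⊆ A)

  _∩_ : Subspace → Subspace → Subspace
  (A ∩ B) P = A P × B P

  _⊥ : Subspace → Subspace
  (A ⊥) P = ∀ Q → A Q → ⟨ P , Q ⟩ ≡ 0ℚ

  Orthogonal : Subspace → Subspace → Set
  Orthogonal A B = ∀ P Q → A P → B Q → ⟨ P , Q ⟩ ≡ 0ℚ

  IsDirectSum : Subspace → Subspace → Subspace → Set
  IsDirectSum V A B =
    (A ⊆ V) × (B ⊆ V)
    × (∀ P → V P → ∃ λ a → ∃ λ b → A a × B b × (P ≈ a +ₚ b))
    × (∀ P → A P → B P → P ≈ 0ₚ)

  IsOrthDirectSum : Subspace → Subspace → Subspace → Set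
  IsOrthDirectSum V A B = IsDirectSum V A B × Orthogonal A B

  flip : Poly n → Poly n → Poly n
  flip Δ P = apply P Δ

  flipImage : Poly n → Subspace → Subspace
  flipImage Δ N Q = ∃ λ P → N P × (Q ≈ flip Δ P)

  -- flip_Δ⁻¹ N for N ⊆ M_Δ : the preimage of N under the bijection
  -- flip_Δ : M_Δ → M_Δ
  flipPreimage : Poly n → Subspace → Subspace
  flipPreimage Δ N P = M Δ P × N (flip Δ P)

  -- σ x^α y^β = ∏ x_{σ i}^{α i} y_{σ i}^{β i}, i.e. the new exponent at
  -- position j is the old exponent at σ⁻¹ j.
  actMono : Permutation′ n → Mono n → Mono n
  actMono σ (α , β) = tabulate (λ j → lookup α (σ ⟨$⟩ˡ j))
                    , tabulate (λ j → lookup β (σ ⟨$⟩ˡ j))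

  act : Permutation′ n → Poly n → Poly n
  act σ P = map (λ { (c , m) → (c , actMono σ m) }) P

  inversions : Permutation′ n → ℕ
  inversions σ = length (filter (λ { (i , j) → (i FinP.<? j) ×-dec ((σ ⟨$⟩ʳ j) FinP.<? (σ ⟨$⟩ʳ i)) })
                        (List.cartesianProduct (allFin n) (allFin n)))

  minusOnePow : ℕ → ℚ
  minusOnePow zero = 1ℚ
  minusOnePow (suc k) = - minusOnePow k

  sign : Permutation′ n → ℚ
  sign σ = minusOnePow (inversions σ)

  Alternating : Poly n → Set
  Alternating Δ = ∀ (σ : Permutation′ n) → act σ Δ ≈ sign σ ·ₚ Δ

module Submission where

-- Polynomials act on polynomials as commuting differential operators, and
-- ⟨P , Q⟩ = Σ α!β! p_αβ q_αβ is a symmetric, positive definite scalar product, so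
-- the finite-dimensional space M_Δ̃ admits an orthogonal projection (Gram–Schmidt).
-- Commuting D(∂) and P(∂) gives α!β! · [x^α y^β] D(∂)(P(∂)Δ) = ⟨P , ∂x^α ∂y^β Δ̃⟩,
-- so P ⊥ M_Δ̃ exactly when D(∂) kills flip_Δ P.  Splitting P ∈ M_Δ, or an operator
-- representing an element of M_Δ, into its projection onto M_Δ̃ plus an orthogonal
-- remainder gives the two decompositions.  Nothing uses that Δ is alternating:
-- the statement holds for every Δ.

open import Defs
open import Data.Nat as ℕ using (ℕ; zero; suc; _∸_; s≤s)
import Data.Nat.Properties as ℕP
import Data.Nat.Coprimality as Coprime
import Data.Integer as ℤ
import Data.Integer.Properties as ℤP
open import Data.Rational as ℚ using (ℚ; 0ℚ; 1ℚ; _+_; _*_; -_; _-_; _/_; mkℚ)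
import Data.Rational.Properties as ℚP
open import Data.Rational.Solver using (module +-*-Solver)
open import Data.List as List using (List; []; _∷_; _++_; map; concatMap)
open import Data.List.Relation.Unary.All as All using (All; []; _∷_)
open import Data.List.Relation.Unary.AllPairs using (AllPairs; []; _∷_)
open import Data.Vec using (Vec; []; _∷_; zipWith)
import Data.Vec.Properties as VecP
open import Data.Vec.Relation.Binary.Pointwise.Inductive using (Pointwise; []; _∷_)
open import Data.Product using (∃; _×_; _,_; proj₁; proj₂)
open import Data.Sum using (_⊎_; inj₁; inj₂)
open import Data.List.Membership.Propositional using (_∈_)
open import Data.List.Membership.Propositional.Properties
  using (∈-++⁺ˡ; ∈-++⁺ʳ; ∈-map⁺; ∈-map⁻; ∈-upTo⁺; ∈-cartesianProduct⁺; ∈-cartesianProductWith⁺)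
open import Data.List.Relation.Unary.Any using (here; there)
open import Relation.Nullary using (Dec; yes; no)
open import Data.Empty using (⊥-elim)
open import Algebra.Properties.Ring ℚP.+-*-ring using (-1*x≈-x)
open import Algebra.Properties.Group ℚP.+-0-group using (x∙y⁻¹≈ε⇒x≈y)
open import Algebra.Properties.CommutativeSemigroup ℕP.*-commutativeSemigroup
  using () renaming (interchange to *-interchange)
open import Relation.Binary.PropositionalEquality
open +-*-Solver using (solve; _:+_; _:*_; _:-_; _:=_; con)

module _ {A : Set} where

  ∑ : List A → (A → ℚ) → ℚ
  ∑ []       f = 0ℚ
  ∑ (x ∷ xs) f = f x + ∑ xs f

  ∑-++ : ∀ xs ys (f : A → ℚ) → ∑ (xs ++ ys) f ≡ ∑ xs f + ∑ ys f
  ∑-++ []       ys f = sym (ℚP.+-identityˡ _)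
  ∑-++ (x ∷ xs) ys f = trans (cong (f x +_) (∑-++ xs ys f)) (sym (ℚP.+-assoc (f x) _ _))

  ∑-congᴬ : ∀ xs {f g : A → ℚ} → All (λ x → f x ≡ g x) xs → ∑ xs f ≡ ∑ xs g
  ∑-congᴬ []       []       = refl
  ∑-congᴬ (x ∷ xs) (p ∷ ps) = cong₂ _+_ p (∑-congᴬ xs ps)

  ∑-cong : ∀ xs {f g : A → ℚ} → (∀ x → f x ≡ g x) → ∑ xs f ≡ ∑ xs g
  ∑-cong []       e = refl
  ∑-cong (x ∷ xs) e = cong₂ _+_ (e x) (∑-cong xs e)

  ∑-0 : ∀ xs → ∑ xs (λ _ → 0ℚ) ≡ 0ℚ
  ∑-0 []       = refl
  ∑-0 (x ∷ xs) = trans (ℚP.+-identityˡ _) (∑-0 xs)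

  ∑-zero : ∀ xs {f : A → ℚ} → All (λ x → f x ≡ 0ℚ) xs → ∑ xs f ≡ 0ℚ
  ∑-zero xs ps = trans (∑-congᴬ xs ps) (∑-0 xs)

  *-distribˡ-∑ : ∀ a xs (f : A → ℚ) → a * ∑ xs f ≡ ∑ xs (λ x → a * f x)
  *-distribˡ-∑ a []       f = ℚP.*-zeroʳ a
  *-distribˡ-∑ a (x ∷ xs) f =
    trans (ℚP.*-distribˡ-+ a (f x) _) (cong (a * f x +_) (*-distribˡ-∑ a xs f))

  ∑-distrib-+ : ∀ xs (f g : A → ℚ) → ∑ xs (λ x → f x + g x) ≡ ∑ xs f + ∑ xs g
  ∑-distrib-+ []       f g = refl
  ∑-distrib-+ (x ∷ xs) f g = trans (cong (f x + g x +_) (∑-distrib-+ xs f g))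
    (solve 4 (λ a b c d → (a :+ b) :+ (c :+ d) := (a :+ c) :+ (b :+ d)) refl
      (f x) (g x) (∑ xs f) (∑ xs g))

  ∑-nonNeg : ∀ xs (f : A → ℚ) → All (λ x → 0ℚ ℚ.≤ f x) xs → 0ℚ ℚ.≤ ∑ xs f
  ∑-nonNeg []       f []       = ℚP.≤-refl
  ∑-nonNeg (x ∷ xs) f (p ∷ ps) = ℚP.+-mono-≤ p (∑-nonNeg xs f ps)

  ∑-nonNeg-≡0 : ∀ xs (f : A → ℚ) → All (λ x → 0ℚ ℚ.≤ f x) xs →
                ∑ xs f ≡ 0ℚ → All (λ x → f x ≡ 0ℚ) xs
  ∑-nonNeg-≡0 []       f []       _ = []
  ∑-nonNeg-≡0 (x ∷ xs) f (p ∷ ps) e = fx≡0 ∷ ∑-nonNeg-≡0 xs f ps rest≡0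
    where
    fx≤0 : f x ℚ.≤ 0ℚ
    fx≤0 = ℚP.≤-trans (ℚP.≤-reflexive (sym (ℚP.+-identityʳ (f x))))
             (ℚP.≤-trans (ℚP.+-monoʳ-≤ (f x) (∑-nonNeg xs f ps)) (ℚP.≤-reflexive e))
    fx≡0 : f x ≡ 0ℚ
    fx≡0 = ℚP.≤-antisym fx≤0 p
    rest≡0 : ∑ xs f ≡ 0ℚ
    rest≡0 = trans (sym (ℚP.+-identityˡ _)) (trans (cong (_+ ∑ xs f) (sym fx≡0)) e)

module _ {A B : Set} where

  ∑-map : ∀ (g : A → B) xs (f : B → ℚ) → ∑ (map g xs) f ≡ ∑ xs (λ x → f (g x))
  ∑-map g []       f = refl
  ∑-map g (x ∷ xs) f = cong (f (g x) +_) (∑-map g xs f)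

  ∑-concatMap : ∀ (g : A → List B) xs (f : B → ℚ) →
                ∑ (concatMap g xs) f ≡ ∑ xs (λ x → ∑ (g x) f)
  ∑-concatMap g []       f = refl
  ∑-concatMap g (x ∷ xs) f =
    trans (∑-++ (g x) (concatMap g xs) f) (cong (∑ (g x) f +_) (∑-concatMap g xs f))

  ∑-comm : ∀ xs ys (f : A → B → ℚ) →
           ∑ xs (λ x → ∑ ys (f x)) ≡ ∑ ys (λ y → ∑ xs (λ x → f x y))
  ∑-comm []       ys f = sym (∑-0 ys)
  ∑-comm (x ∷ xs) ys f = trans (cong (∑ ys (f x) +_) (∑-comm xs ys f))
    (sym (∑-distrib-+ ys (f x) (λ y → ∑ xs (λ x′ → f x′ y))))

toℚ : ℕ → ℚ
toℚ k = ℤ.+ k / 1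

toℚ≡mkℚ : ∀ k → toℚ k ≡ mkℚ (ℤ.+ k) 0 (Coprime.sym (Coprime.1-coprimeTo k))
toℚ≡mkℚ k = ℚP.normalize-coprime _

toℚ-* : ∀ a b → toℚ (a ℕ.* b) ≡ toℚ a * toℚ b
toℚ-* a b rewrite toℚ≡mkℚ a | toℚ≡mkℚ b = cong (_/ 1) (ℤP.pos-* a b)

toℚ-pos : ∀ k .{{_ : ℕ.NonZero k}} → ℚ.Positive (toℚ k)
toℚ-pos k = ℚP.normalize-pos k 1

*-cancelˡ-≡0 : ∀ p q .{{_ : ℚ.NonZero p}} → p * q ≡ 0ℚ → q ≡ 0ℚ
*-cancelˡ-≡0 p q pq≡0 = begin
  q                  ≡⟨ sym (ℚP.*-identityˡ q) ⟩
  1ℚ * q             ≡⟨ cong (_* q) (sym (ℚP.*-inverseˡ p)) ⟩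
  ℚ.1/ p * p * q     ≡⟨ ℚP.*-assoc (ℚ.1/ p) p q ⟩
  ℚ.1/ p * (p * q)   ≡⟨ cong (ℚ.1/ p *_) pq≡0 ⟩
  ℚ.1/ p * 0ℚ        ≡⟨ ℚP.*-zeroʳ (ℚ.1/ p) ⟩
  0ℚ                 ∎
  where open ≡-Reasoning

square-nonNeg : ∀ c → ℚ.NonNegative (c * c)
square-nonNeg c@(mkℚ (ℤ.+ _)    _ _) = ℚP.nonNeg*nonNeg⇒nonNeg c c
square-nonNeg c@(mkℚ ℤ.-[1+ _ ] _ _) = ℚP.nonPos*nonPos⇒nonPos c c

weighted-square-nonNeg : ∀ w c .{{_ : ℚ.Positive w}} → 0ℚ ℚ.≤ c * (w * c)
weighted-square-nonNeg w c = ℚP.≤-trans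
  (ℚP.nonNegative⁻¹ _ {{ℚP.nonNeg*nonNeg⇒nonNeg w {{ℚP.pos⇒nonNeg w}} (c * c) {{square-nonNeg c}}}})
  (ℚP.≤-reflexive (solve 2 (λ w c → w :* (c :* c) := c :* (w :* c)) refl w c))

weighted-square-≡0 : ∀ w c .{{_ : ℚ.Positive w}} → c * (w * c) ≡ 0ℚ → c ≡ 0ℚ
weighted-square-≡0 w c e with c ℚ.≟ 0ℚ
... | yes c≡0 = c≡0
... | no  c≢0 = *-cancelˡ-≡0 w c {{ℚP.pos⇒nonZero w}} (*-cancelˡ-≡0 c (w * c) {{ℚ.≢-nonZero c≢0}} e)

module _ {n : ℕ} where

  -- fall and prodℕ are declared under Defs' module parameter n, on which they
  -- do not depend; hence the explicit {n}.
  fall-< : ∀ b k → b ℕ.< k → fall {n} b k ≡ 0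
  fall-< zero    (suc k) _         = refl
  fall-< (suc b) (suc k) (s≤s b<k) =
    trans (cong (suc b ℕ.*_) (fall-< b k b<k)) (ℕP.*-zeroʳ (suc b))

  fall-+ : ∀ x j k → fall {n} x (j ℕ.+ k) ≡ fall {n} x j ℕ.* fall {n} (x ∸ j) k
  fall-+ x zero    k = sym (ℕP.+-identityʳ _)
  fall-+ x (suc j) k = trans (cong (x ℕ.*_) (fall-+ (x ∸ 1) j k))
    (trans (sym (ℕP.*-assoc x _ _))
      (cong (λ y → x ℕ.* fall {n} (x ∸ 1) j ℕ.* fall {n} y k) (ℕP.∸-+-assoc x 1 j)))

  fall-self-nonZero : ∀ b → ℕ.NonZero (fall {n} b b)
  fall-self-nonZero zero    = _
  fall-self-nonZero (suc b) = ℕP.m*n≢0 (suc b) (fall {n} b b) {{_}} {{fall-self-nonZero b}}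

  fallᵥ : ∀ {k} → Vec ℕ k → Vec ℕ k → ℕ
  fallᵥ δ μ = prodℕ {n} (zipWith (fall {n}) δ μ)

  fallᵥ-+ : ∀ {k} (x j i : Vec ℕ k) →
            fallᵥ x (zipWith ℕ._+_ j i) ≡ fallᵥ x j ℕ.* fallᵥ (zipWith _∸_ x j) i
  fallᵥ-+ []      []      []      = refl
  fallᵥ-+ (a ∷ x) (b ∷ j) (c ∷ i) =
    trans (cong₂ ℕ._*_ (fall-+ a b c) (fallᵥ-+ x j i))
      (*-interchange (fall {n} a b) _ (fallᵥ x j) _)

  fallᵥ-self-nonZero : ∀ {k} (v : Vec ℕ k) → ℕ.NonZero (fallᵥ v v)
  fallᵥ-self-nonZero []      = _
  fallᵥ-self-nonZero (a ∷ v) =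
    ℕP.m*n≢0 _ _ {{fall-self-nonZero a}} {{fallᵥ-self-nonZero v}}

  ≤ᵥ-or-fallᵥ≡0 : ∀ {k} (δ μ : Vec ℕ k) → Pointwise ℕ._≤_ μ δ ⊎ fallᵥ δ μ ≡ 0
  ≤ᵥ-or-fallᵥ≡0 []      []      = inj₁ []
  ≤ᵥ-or-fallᵥ≡0 (a ∷ δ) (b ∷ μ) with b ℕ.≤? a | ≤ᵥ-or-fallᵥ≡0 δ μ
  ... | yes b≤a | inj₁ μ≤δ = inj₁ (b≤a ∷ μ≤δ)
  ... | yes _   | inj₂ z   = inj₂ (trans (cong (fall {n} a b ℕ.*_) z) (ℕP.*-zeroʳ (fall {n} a b)))
  ... | no  b≰a | _        = inj₂ (cong (ℕ._* fallᵥ δ μ) (fall-< a b (ℕP.≰⇒> b≰a)))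

  ∸-+-cancelᵥ : ∀ {k} {δ μ : Vec ℕ k} → Pointwise ℕ._≤_ μ δ →
                zipWith ℕ._+_ (zipWith _∸_ δ μ) μ ≡ δ
  ∸-+-cancelᵥ []          = refl
  ∸-+-cancelᵥ (b≤a ∷ μ≤δ) = cong₂ _∷_ (ℕP.m∸n+n≡m b≤a) (∸-+-cancelᵥ μ≤δ)

  +-∸-cancelᵥ : ∀ {k} (γ μ : Vec ℕ k) → zipWith _∸_ (zipWith ℕ._+_ γ μ) μ ≡ γ
  +-∸-cancelᵥ []      []      = refl
  +-∸-cancelᵥ (a ∷ γ) (b ∷ μ) = cong₂ _∷_ (ℕP.m+n∸n≡m a b) (+-∸-cancelᵥ γ μ)

  infixl 6 _⊕_ _⊖_
  infix 4 _∣ₘ_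

  _⊕_ : Mono n → Mono n → Mono n
  (α , β) ⊕ (γ , δ) = zipWith ℕ._+_ α γ , zipWith ℕ._+_ β δ

  _⊖_ : Mono n → Mono n → Mono n
  (α , β) ⊖ (γ , δ) = zipWith _∸_ α γ , zipWith _∸_ β δ

  _∣ₘ_ : Mono n → Mono n → Set
  (α , β) ∣ₘ (γ , δ) = Pointwise ℕ._≤_ α γ × Pointwise ℕ._≤_ β δ

  -- ∂^μ (x^δ) = fallₘ δ μ · x^(δ ⊖ μ), matching ∂mono-term.
  fallₘ : Mono n → Mono n → ℕ
  fallₘ (γ , δ) (α , β) = fallᵥ γ α ℕ.* fallᵥ δ β

  ⊕-assoc : ∀ γ μ ν → γ ⊕ μ ⊕ ν ≡ γ ⊕ (μ ⊕ ν)
  ⊕-assoc (a , b) (c , d) (e , f) =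
    cong₂ _,_ (VecP.zipWith-assoc ℕP.+-assoc a c e) (VecP.zipWith-assoc ℕP.+-assoc b d f)

  ⊕-comm : ∀ μ ν → μ ⊕ ν ≡ ν ⊕ μ
  ⊕-comm (a , b) (c , d) =
    cong₂ _,_ (VecP.zipWith-comm ℕP.+-comm a c) (VecP.zipWith-comm ℕP.+-comm b d)

  mono0-⊕ : ∀ μ → mono0 ⊕ μ ≡ μ
  mono0-⊕ (a , b) =
    cong₂ _,_ (VecP.zipWith-identityˡ ℕP.+-identityˡ a) (VecP.zipWith-identityˡ ℕP.+-identityˡ b)

  ⊕-⊖ : ∀ γ μ → γ ⊕ μ ⊖ μ ≡ γ
  ⊕-⊖ (a , b) (c , d) = cong₂ _,_ (+-∸-cancelᵥ a c) (+-∸-cancelᵥ b d)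

  ∣ₘ⇒⊖-⊕ : ∀ {μ δ} → μ ∣ₘ δ → δ ⊖ μ ⊕ μ ≡ δ
  ∣ₘ⇒⊖-⊕ (p , q) = cong₂ _,_ (∸-+-cancelᵥ p) (∸-+-cancelᵥ q)

  ∣ₘ-or-fallₘ≡0 : ∀ δ μ → μ ∣ₘ δ ⊎ fallₘ δ μ ≡ 0
  ∣ₘ-or-fallₘ≡0 (a , b) (c , d) with ≤ᵥ-or-fallᵥ≡0 a c | ≤ᵥ-or-fallᵥ≡0 b d
  ... | inj₁ p | inj₁ q = inj₁ (p , q)
  ... | inj₂ z | _      = inj₂ (cong (ℕ._* fallᵥ b d) z)
  ... | inj₁ _ | inj₂ z = inj₂ (trans (cong (fallᵥ a c ℕ.*_) z) (ℕP.*-zeroʳ (fallᵥ a c)))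

  fallₘ-⊕ : ∀ ρ ν μ → fallₘ ρ (ν ⊕ μ) ≡ fallₘ ρ ν ℕ.* fallₘ (ρ ⊖ ν) μ
  fallₘ-⊕ (a , b) (c , d) (e , f) =
    trans (cong₂ ℕ._*_ (fallᵥ-+ a c e) (fallᵥ-+ b d f))
      (*-interchange (fallᵥ a c) _ (fallᵥ b d) _)

  -- weight (α , β) = α! β!
  weight : Mono n → ℚ
  weight μ = toℚ (fallₘ μ μ)

  weight-pos : ∀ μ → ℚ.Positive (weight μ)
  weight-pos (a , b) =
    toℚ-pos _ {{ℕP.m*n≢0 _ _ {{fallᵥ-self-nonZero a}} {{fallᵥ-self-nonZero b}}}}

  δₘ : Mono n → Mono n → ℚ
  δₘ m x with m ≟ₘ x
  ... | yes _ = 1ℚ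
  ... | no  _ = 0ℚ

  δₘ-refl : ∀ m → δₘ m m ≡ 1ℚ
  δₘ-refl m with m ≟ₘ m
  ... | yes _   = refl
  ... | no  m≢m = ⊥-elim (m≢m refl)

  δₘ-≢ : ∀ {m x} → m ≢ x → δₘ m x ≡ 0ℚ
  δₘ-≢ {m} {x} m≢x with m ≟ₘ x
  ... | yes m≡x = ⊥-elim (m≢x m≡x)
  ... | no  _   = refl

  δₘ-comm : ∀ m x → δₘ m x ≡ δₘ x m
  δₘ-comm m x with m ≟ₘ x
  ... | yes refl = sym (δₘ-refl m)
  ... | no  m≢x  = sym (δₘ-≢ (λ x≡m → m≢x (sym x≡m)))

  δₘ-sym : ∀ (f : Mono n → ℚ) μ ν → f μ * δₘ ν μ ≡ f ν * δₘ μ ν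
  δₘ-sym f μ ν = trans (move μ ν) (cong (f ν *_) (δₘ-comm ν μ))
    where
    move : ∀ μ ν → f μ * δₘ ν μ ≡ f ν * δₘ ν μ
    move μ ν with ν ≟ₘ μ
    ... | yes refl = refl
    ... | no  _    = trans (ℚP.*-zeroʳ (f μ)) (sym (ℚP.*-zeroʳ (f ν)))

  coeff-∷ : ∀ c m P x → coeff ((c , m) ∷ P) x ≡ c * δₘ m x + coeff P x
  coeff-∷ c m P x with m ≟ₘ x
  ... | yes _ = cong (_+ coeff P x) (sym (ℚP.*-identityʳ c))
  ... | no  _ = sym (trans (cong (_+ coeff P x) (ℚP.*-zeroʳ c)) (ℚP.+-identityˡ _))

  coeff-++ : ∀ P Q x → coeff (P ++ Q) x ≡ coeff P x + coeff Q x
  coeff-++ []            Q x = sym (ℚP.+-identityˡ _)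
  coeff-++ ((c , m) ∷ P) Q x = begin
    coeff ((c , m) ∷ P ++ Q) x              ≡⟨ coeff-∷ c m (P ++ Q) x ⟩
    c * δₘ m x + coeff (P ++ Q) x           ≡⟨ cong (c * δₘ m x +_) (coeff-++ P Q x) ⟩
    c * δₘ m x + (coeff P x + coeff Q x)    ≡⟨ sym (ℚP.+-assoc (c * δₘ m x) _ _) ⟩
    c * δₘ m x + coeff P x + coeff Q x      ≡⟨ cong (_+ coeff Q x) (sym (coeff-∷ c m P x)) ⟩
    coeff ((c , m) ∷ P) x + coeff Q x       ∎
    where open ≡-Reasoning

  coeff-·ₚ : ∀ a P x → coeff (a ·ₚ P) x ≡ a * coeff P x
  coeff-·ₚ a []            x = sym (ℚP.*-zeroʳ a)
  coeff-·ₚ a ((c , m) ∷ P) x = begin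
    coeff ((a * c , m) ∷ a ·ₚ P) x          ≡⟨ coeff-∷ (a * c) m (a ·ₚ P) x ⟩
    a * c * δₘ m x + coeff (a ·ₚ P) x       ≡⟨ cong₂ _+_ (ℚP.*-assoc a c _) (coeff-·ₚ a P x) ⟩
    a * (c * δₘ m x) + a * coeff P x        ≡⟨ sym (ℚP.*-distribˡ-+ a _ _) ⟩
    a * (c * δₘ m x + coeff P x)            ≡⟨ cong (a *_) (sym (coeff-∷ c m P x)) ⟩
    a * coeff ((c , m) ∷ P) x               ∎
    where open ≡-Reasoning

  ⟪_∣_⟫ : Poly n → (Mono n → ℚ) → ℚ
  ⟪ R ∣ g ⟫ = ∑ R (λ t → proj₁ t * g (proj₂ t))

  ⟪⟫-++ : ∀ R S g → ⟪ R ++ S ∣ g ⟫ ≡ ⟪ R ∣ g ⟫ + ⟪ S ∣ g ⟫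
  ⟪⟫-++ R S g = ∑-++ R S _

  ⟪⟫-·ₚ : ∀ a R g → ⟪ a ·ₚ R ∣ g ⟫ ≡ a * ⟪ R ∣ g ⟫
  ⟪⟫-·ₚ a R g = begin
    ⟪ a ·ₚ R ∣ g ⟫                                  ≡⟨ ∑-map _ R _ ⟩
    ∑ R (λ t → a * proj₁ t * g (proj₂ t))           ≡⟨ ∑-cong R (λ t → ℚP.*-assoc a (proj₁ t) _) ⟩
    ∑ R (λ t → a * (proj₁ t * g (proj₂ t)))         ≡⟨ sym (*-distribˡ-∑ a R _) ⟩
    a * ⟪ R ∣ g ⟫                                   ∎
    where open ≡-Reasoning

  ⟪⟫-cong : ∀ R {g h : Mono n → ℚ} → (∀ μ → g μ ≡ h μ) → ⟪ R ∣ g ⟫ ≡ ⟪ R ∣ h ⟫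
  ⟪⟫-cong R e = ∑-cong R (λ t → cong (proj₁ t *_) (e (proj₂ t)))

  *-distribˡ-⟪⟫ : ∀ a R g → a * ⟪ R ∣ g ⟫ ≡ ⟪ R ∣ (λ μ → a * g μ) ⟫
  *-distribˡ-⟪⟫ a R g = trans (*-distribˡ-∑ a R _)
    (∑-cong R (λ t → solve 3 (λ a c x → a :* (c :* x) := c :* (a :* x)) refl a (proj₁ t) (g (proj₂ t))))

  ⟪⟫-comm : ∀ R S (h : Mono n → Mono n → ℚ) →
            ⟪ R ∣ (λ μ → ⟪ S ∣ h μ ⟫) ⟫ ≡ ⟪ S ∣ (λ ν → ⟪ R ∣ (λ μ → h μ ν) ⟫) ⟫
  ⟪⟫-comm R S h = begin
    ⟪ R ∣ (λ μ → ⟪ S ∣ h μ ⟫) ⟫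
      ≡⟨ ∑-cong R (λ t → *-distribˡ-∑ (proj₁ t) S _) ⟩
    ∑ R (λ t → ∑ S (λ s → proj₁ t * (proj₁ s * h (proj₂ t) (proj₂ s))))
      ≡⟨ ∑-comm R S _ ⟩
    ∑ S (λ s → ∑ R (λ t → proj₁ t * (proj₁ s * h (proj₂ t) (proj₂ s))))
      ≡⟨ ∑-cong S (λ s → ∑-cong R (λ t → swap (proj₁ t) (proj₁ s) _)) ⟩
    ∑ S (λ s → ∑ R (λ t → proj₁ s * (proj₁ t * h (proj₂ t) (proj₂ s))))
      ≡⟨ ∑-cong S (λ s → sym (*-distribˡ-∑ (proj₁ s) R _)) ⟩
    ⟪ S ∣ (λ ν → ⟪ R ∣ (λ μ → h μ ν) ⟫) ⟫ ∎
    where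
    open ≡-Reasoning
    swap : ∀ a b x → a * (b * x) ≡ b * (a * x)
    swap = solve 3 (λ a b x → a :* (b :* x) := b :* (a :* x)) refl

  coeff-as-⟪⟫ : ∀ Q μ → coeff Q μ ≡ ⟪ Q ∣ (λ ν → δₘ ν μ) ⟫
  coeff-as-⟪⟫ []            μ = refl
  coeff-as-⟪⟫ ((c , m) ∷ Q) μ = trans (coeff-∷ c m Q μ) (cong (c * δₘ m μ +_) (coeff-as-⟪⟫ Q μ))

  coeff-apply : ∀ R F γ → coeff (apply R F) γ ≡ ⟪ R ∣ (λ μ → coeff (∂mono μ F) γ) ⟫
  coeff-apply []            F γ = refl
  coeff-apply ((c , μ) ∷ R) F γ = begin
    coeff (c ·ₚ ∂mono μ F ++ apply R F) γ
      ≡⟨ coeff-++ (c ·ₚ ∂mono μ F) _ γ ⟩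
    coeff (c ·ₚ ∂mono μ F) γ + coeff (apply R F) γ
      ≡⟨ cong₂ _+_ (coeff-·ₚ c (∂mono μ F) γ) (coeff-apply R F γ) ⟩
    c * coeff (∂mono μ F) γ + ⟪ R ∣ _ ⟫ ∎
    where open ≡-Reasoning

  -- Since ⊖ truncates, δ ⊖ μ ≡ γ does not force δ ≡ γ ⊕ μ; in that case μ does not
  -- divide δ and the falling factorial vanishes.
  ∂mono-term-coeff : ∀ d δ μ γ →
    d * toℚ (fallₘ δ μ) * δₘ (δ ⊖ μ) γ ≡ toℚ (fallₘ (γ ⊕ μ) μ) * (d * δₘ δ (γ ⊕ μ))
  ∂mono-term-coeff d δ μ γ with δ ≟ₘ (γ ⊕ μ)
  ... | yes refl = begin
    d * f * δₘ (γ ⊕ μ ⊖ μ) γ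
      ≡⟨ cong (λ m → d * f * δₘ m γ) (⊕-⊖ γ μ) ⟩
    d * f * δₘ γ γ
      ≡⟨ cong (d * f *_) (δₘ-refl γ) ⟩
    d * f * 1ℚ
      ≡⟨ solve 2 (λ d f → d :* f :* con 1ℚ := f :* (d :* con 1ℚ)) refl d f ⟩
    f * (d * 1ℚ) ∎
    where
    open ≡-Reasoning
    f = toℚ (fallₘ (γ ⊕ μ) μ)
  ... | no δ≢γ⊕μ = trans lhs≡0 (sym (trans (cong (f *_) (ℚP.*-zeroʳ d)) (ℚP.*-zeroʳ f)))
    where
    f = toℚ (fallₘ (γ ⊕ μ) μ)
    lhs≡0 : d * toℚ (fallₘ δ μ) * δₘ (δ ⊖ μ) γ ≡ 0ℚ
    lhs≡0 = by-cases ((δ ⊖ μ) ≟ₘ γ) (∣ₘ-or-fallₘ≡0 δ μ)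
      where
      by-cases : Dec (δ ⊖ μ ≡ γ) → μ ∣ₘ δ ⊎ fallₘ δ μ ≡ 0 → d * toℚ (fallₘ δ μ) * δₘ (δ ⊖ μ) γ ≡ 0ℚ
      by-cases (no δ⊖μ≢γ) _ = trans (cong (d * toℚ (fallₘ δ μ) *_) (δₘ-≢ δ⊖μ≢γ))
                                (ℚP.*-zeroʳ (d * toℚ (fallₘ δ μ)))
      by-cases (yes refl) (inj₁ μ∣δ) = ⊥-elim (δ≢γ⊕μ (sym (∣ₘ⇒⊖-⊕ μ∣δ)))
      by-cases (yes refl) (inj₂ z)   = trans (cong (λ k → d * toℚ k * δₘ (δ ⊖ μ) (δ ⊖ μ)) z)
                                         (solve 2 (λ d x → d :* con 0ℚ :* x := con 0ℚ) refl d _)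

  coeff-∂ : ∀ μ F γ → coeff (∂mono μ F) γ ≡ toℚ (fallₘ (γ ⊕ μ) μ) * coeff F (γ ⊕ μ)
  coeff-∂ μ []            γ = sym (ℚP.*-zeroʳ (toℚ (fallₘ (γ ⊕ μ) μ)))
  coeff-∂ μ ((d , δ) ∷ F) γ = begin
    coeff ((d * toℚ (fallₘ δ μ) , δ ⊖ μ) ∷ ∂mono μ F) γ
      ≡⟨ coeff-∷ (d * toℚ (fallₘ δ μ)) (δ ⊖ μ) (∂mono μ F) γ ⟩
    d * toℚ (fallₘ δ μ) * δₘ (δ ⊖ μ) γ + coeff (∂mono μ F) γ
      ≡⟨ cong₂ _+_ (∂mono-term-coeff d δ μ γ) (coeff-∂ μ F γ) ⟩
    f * (d * δₘ δ (γ ⊕ μ)) + f * coeff F (γ ⊕ μ)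
      ≡⟨ sym (ℚP.*-distribˡ-+ f (d * δₘ δ (γ ⊕ μ)) (coeff F (γ ⊕ μ))) ⟩
    f * (d * δₘ δ (γ ⊕ μ) + coeff F (γ ⊕ μ))
      ≡⟨ cong (f *_) (sym (coeff-∷ d δ F (γ ⊕ μ))) ⟩
    f * coeff ((d , δ) ∷ F) (γ ⊕ μ) ∎
    where
    open ≡-Reasoning
    f = toℚ (fallₘ (γ ⊕ μ) μ)

  fallₘ-⊕-⊕ : ∀ γ μ ν → fallₘ (γ ⊕ μ) μ ℕ.* fallₘ (γ ⊕ μ ⊕ ν) ν ≡ fallₘ (γ ⊕ (μ ⊕ ν)) (μ ⊕ ν)
  fallₘ-⊕-⊕ γ μ ν = begin
    fallₘ (γ ⊕ μ) μ ℕ.* fallₘ ρ ν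
      ≡⟨ ℕP.*-comm (fallₘ (γ ⊕ μ) μ) _ ⟩
    fallₘ ρ ν ℕ.* fallₘ (γ ⊕ μ) μ
      ≡⟨ cong (λ σ → fallₘ ρ ν ℕ.* fallₘ σ μ) (sym (⊕-⊖ (γ ⊕ μ) ν)) ⟩
    fallₘ ρ ν ℕ.* fallₘ (ρ ⊖ ν) μ
      ≡⟨ sym (fallₘ-⊕ ρ ν μ) ⟩
    fallₘ ρ (ν ⊕ μ)
      ≡⟨ cong₂ fallₘ (⊕-assoc γ μ ν) (⊕-comm ν μ) ⟩
    fallₘ (γ ⊕ (μ ⊕ ν)) (μ ⊕ ν) ∎
    where
    open ≡-Reasoning
    ρ = γ ⊕ μ ⊕ ν

  ∂-∂ : ∀ μ ν F → ∂mono μ (∂mono ν F) ≈ ∂mono (μ ⊕ ν) F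
  ∂-∂ μ ν F γ = begin
    coeff (∂mono μ (∂mono ν F)) γ
      ≡⟨ coeff-∂ μ (∂mono ν F) γ ⟩
    toℚ a * coeff (∂mono ν F) (γ ⊕ μ)
      ≡⟨ cong (toℚ a *_) (coeff-∂ ν F (γ ⊕ μ)) ⟩
    toℚ a * (toℚ b * coeff F (γ ⊕ μ ⊕ ν))
      ≡⟨ sym (ℚP.*-assoc (toℚ a) (toℚ b) _) ⟩
    toℚ a * toℚ b * coeff F (γ ⊕ μ ⊕ ν)
      ≡⟨ cong₂ _*_ (sym (toℚ-* a b)) (cong (coeff F) (⊕-assoc γ μ ν)) ⟩
    toℚ (a ℕ.* b) * coeff F (γ ⊕ (μ ⊕ ν))
      ≡⟨ cong (λ k → toℚ k * coeff F (γ ⊕ (μ ⊕ ν))) (fallₘ-⊕-⊕ γ μ ν) ⟩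
    toℚ (fallₘ (γ ⊕ (μ ⊕ ν)) (μ ⊕ ν)) * coeff F (γ ⊕ (μ ⊕ ν))
      ≡⟨ sym (coeff-∂ (μ ⊕ ν) F γ) ⟩
    coeff (∂mono (μ ⊕ ν) F) γ ∎
    where
    open ≡-Reasoning
    a = fallₘ (γ ⊕ μ) μ
    b = fallₘ (γ ⊕ μ ⊕ ν) ν

  ∂-cong : ∀ μ {F G} → F ≈ G → ∂mono μ F ≈ ∂mono μ G
  ∂-cong μ {F} {G} F≈G γ = trans (coeff-∂ μ F γ)
    (trans (cong (toℚ (fallₘ (γ ⊕ μ) μ) *_) (F≈G (γ ⊕ μ))) (sym (coeff-∂ μ G γ)))

  apply-congʳ : ∀ R {F G} → F ≈ G → apply R F ≈ apply R G
  apply-congʳ R {F} {G} F≈G γ = trans (coeff-apply R F γ)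
    (trans (⟪⟫-cong R (λ μ → ∂-cong μ {F} {G} F≈G γ)) (sym (coeff-apply R G γ)))

  coeff-∂-apply : ∀ μ S F γ →
    coeff (∂mono μ (apply S F)) γ ≡ ⟪ S ∣ (λ ν → coeff (∂mono (μ ⊕ ν) F) γ) ⟫
  coeff-∂-apply μ S F γ = begin
    coeff (∂mono μ (apply S F)) γ
      ≡⟨ coeff-∂ μ (apply S F) γ ⟩
    toℚ a * coeff (apply S F) (γ ⊕ μ)
      ≡⟨ cong (toℚ a *_) (coeff-apply S F (γ ⊕ μ)) ⟩
    toℚ a * ⟪ S ∣ (λ ν → coeff (∂mono ν F) (γ ⊕ μ)) ⟫
      ≡⟨ *-distribˡ-⟪⟫ (toℚ a) S _ ⟩
    ⟪ S ∣ (λ ν → toℚ a * coeff (∂mono ν F) (γ ⊕ μ)) ⟫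
      ≡⟨ ⟪⟫-cong S (λ ν → sym (coeff-∂ μ (∂mono ν F) γ)) ⟩
    ⟪ S ∣ (λ ν → coeff (∂mono μ (∂mono ν F)) γ) ⟫
      ≡⟨ ⟪⟫-cong S (λ ν → ∂-∂ μ ν F γ) ⟩
    ⟪ S ∣ (λ ν → coeff (∂mono (μ ⊕ ν) F) γ) ⟫ ∎
    where
    open ≡-Reasoning
    a = fallₘ (γ ⊕ μ) μ

  coeff-apply-apply : ∀ R S F γ →
    coeff (apply R (apply S F)) γ ≡ ⟪ R ∣ (λ μ → ⟪ S ∣ (λ ν → coeff (∂mono (μ ⊕ ν) F) γ) ⟫) ⟫
  coeff-apply-apply R S F γ =
    trans (coeff-apply R (apply S F) γ) (⟪⟫-cong R (λ μ → coeff-∂-apply μ S F γ))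

  apply-comm : ∀ R S F → apply R (apply S F) ≈ apply S (apply R F)
  apply-comm R S F γ = begin
    coeff (apply R (apply S F)) γ
      ≡⟨ coeff-apply-apply R S F γ ⟩
    ⟪ R ∣ (λ μ → ⟪ S ∣ (λ ν → coeff (∂mono (μ ⊕ ν) F) γ) ⟫) ⟫
      ≡⟨ ⟪⟫-comm R S _ ⟩
    ⟪ S ∣ (λ ν → ⟪ R ∣ (λ μ → coeff (∂mono (μ ⊕ ν) F) γ) ⟫) ⟫
      ≡⟨ ⟪⟫-cong S (λ ν → ⟪⟫-cong R (λ μ → cong (λ σ → coeff (∂mono σ F) γ) (⊕-comm μ ν))) ⟩
    ⟪ S ∣ (λ ν → ⟪ R ∣ (λ μ → coeff (∂mono (ν ⊕ μ) F) γ) ⟫) ⟫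
      ≡⟨ sym (coeff-apply-apply S R F γ) ⟩
    coeff (apply S (apply R F)) γ ∎
    where open ≡-Reasoning

  infixl 7 _*ₚ_
  _*ₚ_ : Poly n → Poly n → Poly n
  R *ₚ S = concatMap (λ t → map (λ s → proj₁ t * proj₁ s , proj₂ t ⊕ proj₂ s) S) R

  ⟪⟫-*ₚ : ∀ R S g → ⟪ R *ₚ S ∣ g ⟫ ≡ ⟪ R ∣ (λ μ → ⟪ S ∣ (λ ν → g (μ ⊕ ν)) ⟫) ⟫
  ⟪⟫-*ₚ R S g = begin
    ⟪ R *ₚ S ∣ g ⟫
      ≡⟨ ∑-concatMap _ R _ ⟩
    ∑ R (λ t → ∑ (map (λ s → proj₁ t * proj₁ s , proj₂ t ⊕ proj₂ s) S) _)
      ≡⟨ ∑-cong R (λ t → ∑-map _ S _) ⟩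
    ∑ R (λ t → ∑ S (λ s → proj₁ t * proj₁ s * g (proj₂ t ⊕ proj₂ s)))
      ≡⟨ ∑-cong R (λ t → ∑-cong S (λ s → ℚP.*-assoc (proj₁ t) (proj₁ s) _)) ⟩
    ∑ R (λ t → ∑ S (λ s → proj₁ t * (proj₁ s * g (proj₂ t ⊕ proj₂ s))))
      ≡⟨ ∑-cong R (λ t → sym (*-distribˡ-∑ (proj₁ t) S _)) ⟩
    ⟪ R ∣ (λ μ → ⟪ S ∣ (λ ν → g (μ ⊕ ν)) ⟫) ⟫ ∎
    where open ≡-Reasoning

  apply-*ₚ : ∀ R S F → apply (R *ₚ S) F ≈ apply R (apply S F)
  apply-*ₚ R S F γ = trans (coeff-apply (R *ₚ S) F γ)
    (trans (⟪⟫-*ₚ R S _) (sym (coeff-apply-apply R S F γ)))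

  apply-++ˡ : ∀ A B F → apply (A ++ B) F ≈ apply A F ++ apply B F
  apply-++ˡ A B F γ = begin
    coeff (apply (A ++ B) F) γ
      ≡⟨ coeff-apply (A ++ B) F γ ⟩
    ⟪ A ++ B ∣ _ ⟫
      ≡⟨ ⟪⟫-++ A B _ ⟩
    ⟪ A ∣ _ ⟫ + ⟪ B ∣ _ ⟫
      ≡⟨ sym (cong₂ _+_ (coeff-apply A F γ) (coeff-apply B F γ)) ⟩
    coeff (apply A F) γ + coeff (apply B F) γ
      ≡⟨ sym (coeff-++ (apply A F) (apply B F) γ) ⟩
    coeff (apply A F ++ apply B F) γ ∎
    where open ≡-Reasoning

  apply-·ₚˡ : ∀ a A F → apply (a ·ₚ A) F ≈ a ·ₚ apply A F
  apply-·ₚˡ a A F γ = begin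
    coeff (apply (a ·ₚ A) F) γ         ≡⟨ coeff-apply (a ·ₚ A) F γ ⟩
    ⟪ a ·ₚ A ∣ _ ⟫                     ≡⟨ ⟪⟫-·ₚ a A _ ⟩
    a * ⟪ A ∣ _ ⟫                      ≡⟨ cong (a *_) (sym (coeff-apply A F γ)) ⟩
    a * coeff (apply A F) γ            ≡⟨ sym (coeff-·ₚ a (apply A F) γ) ⟩
    coeff (a ·ₚ apply A F) γ           ∎
    where open ≡-Reasoning

  insert : ℚ × Mono n → Poly n → Poly n
  insert (c , m) []              = (c , m) ∷ []
  insert (c , m) ((d , m′) ∷ N) with m′ ≟ₘ m
  ... | yes _ = (d + c , m′) ∷ N
  ... | no  _ = (d , m′) ∷ insert (c , m) N

  normalise : Poly n → Poly n
  normalise = List.foldr insert []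

  Distinct : Poly n → Set
  Distinct = AllPairs (λ s t → proj₂ s ≢ proj₂ t)

  ⟪⟫-insert : ∀ c m N g → ⟪ insert (c , m) N ∣ g ⟫ ≡ c * g m + ⟪ N ∣ g ⟫
  ⟪⟫-insert c m []              g = refl
  ⟪⟫-insert c m ((d , m′) ∷ N) g with m′ ≟ₘ m
  ... | yes refl = solve 4 (λ d c x r → (d :+ c) :* x :+ r := c :* x :+ (d :* x :+ r)) refl
                     d c (g m) ⟪ N ∣ g ⟫
  ... | no  _    = trans (cong (d * g m′ +_) (⟪⟫-insert c m N g))
                     (solve 3 (λ a b r → a :+ (b :+ r) := b :+ (a :+ r)) refl (d * g m′) (c * g m) ⟪ N ∣ g ⟫)

  ⟪⟫-normalise : ∀ R g → ⟪ normalise R ∣ g ⟫ ≡ ⟪ R ∣ g ⟫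
  ⟪⟫-normalise []            g = refl
  ⟪⟫-normalise ((c , m) ∷ R) g =
    trans (⟪⟫-insert c m (normalise R) g) (cong (c * g m +_) (⟪⟫-normalise R g))

  coeff-normalise : ∀ R x → coeff (normalise R) x ≡ coeff R x
  coeff-normalise R x = trans (coeff-as-⟪⟫ (normalise R) x)
    (trans (⟪⟫-normalise R _) (sym (coeff-as-⟪⟫ R x)))

  insert-∌ : ∀ c {m m₀} N → m₀ ≢ m → All (λ t → m₀ ≢ proj₂ t) N →
             All (λ t → m₀ ≢ proj₂ t) (insert (c , m) N)
  insert-∌ c []              m₀≢m []       = m₀≢m ∷ []
  insert-∌ c {m} ((d , m′) ∷ N) m₀≢m (p ∷ ps) with m′ ≟ₘ m
  ... | yes _ = p ∷ ps
  ... | no  _ = p ∷ insert-∌ c N m₀≢m ps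

  insert-distinct : ∀ c m N → Distinct N → Distinct (insert (c , m) N)
  insert-distinct c m []              _          = [] ∷ []
  insert-distinct c m ((d , m′) ∷ N) (ps ∷ dN) with m′ ≟ₘ m
  ... | yes _    = ps ∷ dN
  ... | no  m′≢m = insert-∌ c N m′≢m ps ∷ insert-distinct c m N dN

  normalise-distinct : ∀ R → Distinct (normalise R)
  normalise-distinct []            = []
  normalise-distinct ((c , m) ∷ R) = insert-distinct c m (normalise R) (normalise-distinct R)

  coeff-∌ : ∀ {m} N → All (λ t → m ≢ proj₂ t) N → coeff N m ≡ 0ℚ
  coeff-∌ []            []       = refl
  coeff-∌ ((d , m′) ∷ N) (p ∷ ps) = begin
    coeff ((d , m′) ∷ N) _
      ≡⟨ coeff-∷ d m′ N _ ⟩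
    d * δₘ m′ _ + coeff N _
      ≡⟨ cong₂ _+_ (cong (d *_) (δₘ-≢ (λ m′≡m → p (sym m′≡m)))) (coeff-∌ N ps) ⟩
    d * 0ℚ + 0ℚ
      ≡⟨ solve 1 (λ d → d :* con 0ℚ :+ con 0ℚ := con 0ℚ) refl d ⟩
    0ℚ ∎
    where open ≡-Reasoning

  distinct-coeff : ∀ N → Distinct N → All (λ t → coeff N (proj₂ t) ≡ proj₁ t) N
  distinct-coeff []            []          = []
  distinct-coeff ((c , m) ∷ N) (ps ∷ dN)   = head ∷ tail N ps (distinct-coeff N dN)
    where
    head : coeff ((c , m) ∷ N) m ≡ c
    head = begin
      coeff ((c , m) ∷ N) m    ≡⟨ coeff-∷ c m N m ⟩
      c * δₘ m m + coeff N m   ≡⟨ cong₂ _+_ (cong (c *_) (δₘ-refl m)) (coeff-∌ N ps) ⟩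
      c * 1ℚ + 0ℚ              ≡⟨ solve 1 (λ c → c :* con 1ℚ :+ con 0ℚ := c) refl c ⟩
      c                        ∎
      where open ≡-Reasoning
    tail : ∀ L → All (λ t → m ≢ proj₂ t) L → All (λ t → coeff N (proj₂ t) ≡ proj₁ t) L →
           All (λ t → coeff ((c , m) ∷ N) (proj₂ t) ≡ proj₁ t) L
    tail []             []       []       = []
    tail ((d , m′) ∷ L) (p ∷ ps) (q ∷ qs) = step ∷ tail L ps qs
      where
      step : coeff ((c , m) ∷ N) m′ ≡ d
      step = trans (coeff-∷ c m N m′)
        (trans (cong₂ _+_ (cong (c *_) (δₘ-≢ p)) q)
          (solve 2 (λ c d → c :* con 0ℚ :+ d := d) refl c d))

  ⟪⟫-via-normalise : ∀ R g → ⟪ R ∣ g ⟫ ≡ ∑ (normalise R) (λ t → coeff R (proj₂ t) * g (proj₂ t))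
  ⟪⟫-via-normalise R g = trans (sym (⟪⟫-normalise R g))
    (∑-congᴬ (normalise R) (All.map by-coeff (distinct-coeff (normalise R) (normalise-distinct R))))
    where
    by-coeff : ∀ {t} → coeff (normalise R) (proj₂ t) ≡ proj₁ t →
               proj₁ t * g (proj₂ t) ≡ coeff R (proj₂ t) * g (proj₂ t)
    by-coeff {t} e = cong (_* g (proj₂ t)) (trans (sym e) (coeff-normalise R (proj₂ t)))

  ⟪⟫-≈0 : ∀ {R} g → R ≈ 0ₚ → ⟪ R ∣ g ⟫ ≡ 0ℚ
  ⟪⟫-≈0 {R} g R≈0 = trans (⟪⟫-via-normalise R g)
    (∑-zero (normalise R) (All.tabulate (λ {t} _ →
      trans (cong (_* g (proj₂ t)) (R≈0 (proj₂ t))) (ℚP.*-zeroˡ (g (proj₂ t))))))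


  infixl 6 _-ₚ_
  _-ₚ_ : Poly n → Poly n → Poly n
  P -ₚ A = P +ₚ ((- 1ℚ) ·ₚ A)

  coeff--ₚ : ∀ P A x → coeff (P -ₚ A) x ≡ coeff P x - coeff A x
  coeff--ₚ P A x = trans (coeff-++ P ((- 1ℚ) ·ₚ A) x)
    (cong (coeff P x +_) (trans (coeff-·ₚ (- 1ℚ) A x) (-1*x≈-x (coeff A x))))

  ≈-+ₚ--ₚ : ∀ P A → P ≈ A +ₚ (P -ₚ A)
  ≈-+ₚ--ₚ P A x = sym (begin
    coeff (A +ₚ (P -ₚ A)) x
      ≡⟨ coeff-++ A (P -ₚ A) x ⟩
    coeff A x + coeff (P -ₚ A) x
      ≡⟨ cong (coeff A x +_) (coeff--ₚ P A x) ⟩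
    coeff A x + (coeff P x - coeff A x)
      ≡⟨ solve 2 (λ a p → a :+ (p :- a) := p) refl (coeff A x) (coeff P x) ⟩
    coeff P x ∎)
    where open ≡-Reasoning

  ⟪⟫-cong-≈ : ∀ {R R′} g → R ≈ R′ → ⟪ R ∣ g ⟫ ≡ ⟪ R′ ∣ g ⟫
  ⟪⟫-cong-≈ {R} {R′} g R≈R′ = x∙y⁻¹≈ε⇒x≈y ⟪ R ∣ g ⟫ ⟪ R′ ∣ g ⟫ (begin
    ⟪ R ∣ g ⟫ - ⟪ R′ ∣ g ⟫                ≡⟨ cong (⟪ R ∣ g ⟫ +_) (sym (-1*x≈-x ⟪ R′ ∣ g ⟫)) ⟩
    ⟪ R ∣ g ⟫ + - 1ℚ * ⟪ R′ ∣ g ⟫         ≡⟨ cong (⟪ R ∣ g ⟫ +_) (sym (⟪⟫-·ₚ (- 1ℚ) R′ g)) ⟩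
    ⟪ R ∣ g ⟫ + ⟪ (- 1ℚ) ·ₚ R′ ∣ g ⟫      ≡⟨ sym (⟪⟫-++ R ((- 1ℚ) ·ₚ R′) g) ⟩
    ⟪ R -ₚ R′ ∣ g ⟫                       ≡⟨ ⟪⟫-≈0 {R -ₚ R′} g R-R′≈0 ⟩
    0ℚ                                    ∎)
    where
    open ≡-Reasoning
    R-R′≈0 : R -ₚ R′ ≈ 0ₚ
    R-R′≈0 x = trans (coeff--ₚ R R′ x)
      (trans (cong (λ c → c - coeff R′ x) (R≈R′ x)) (ℚP.+-inverseʳ (coeff R′ x)))

  apply-congˡ : ∀ {R R′} F → R ≈ R′ → apply R F ≈ apply R′ F
  apply-congˡ {R} {R′} F R≈R′ γ = trans (coeff-apply R F γ)
    (trans (⟪⟫-cong-≈ {R} {R′} _ R≈R′) (sym (coeff-apply R′ F γ)))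

  -- The scalar product

  ⟨⟩-formula : ∀ P Q → ⟨ P , Q ⟩ ≡ ⟪ P ∣ (λ μ → weight μ * coeff Q μ) ⟫
  ⟨⟩-formula P Q = trans (coeff-apply P Q mono0) (⟪⟫-cong P at-origin)
    where
    at-origin : ∀ μ → coeff (∂mono μ Q) mono0 ≡ weight μ * coeff Q μ
    at-origin μ = trans (coeff-∂ μ Q mono0)
      (cong (λ σ → toℚ (fallₘ σ μ) * coeff Q σ) (mono0-⊕ μ))

  ⟨⟩-double : ∀ P Q → ⟨ P , Q ⟩ ≡ ⟪ P ∣ (λ μ → ⟪ Q ∣ (λ ν → weight μ * δₘ ν μ) ⟫) ⟫
  ⟨⟩-double P Q = trans (⟨⟩-formula P Q) (⟪⟫-cong P (λ μ →
    trans (cong (weight μ *_) (coeff-as-⟪⟫ Q μ)) (*-distribˡ-⟪⟫ (weight μ) Q _)))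

  ⟨⟩-sym : ∀ P Q → ⟨ P , Q ⟩ ≡ ⟨ Q , P ⟩
  ⟨⟩-sym P Q = begin
    ⟨ P , Q ⟩
      ≡⟨ ⟨⟩-double P Q ⟩
    ⟪ P ∣ (λ μ → ⟪ Q ∣ (λ ν → weight μ * δₘ ν μ) ⟫) ⟫
      ≡⟨ ⟪⟫-comm P Q _ ⟩
    ⟪ Q ∣ (λ ν → ⟪ P ∣ (λ μ → weight μ * δₘ ν μ) ⟫) ⟫
      ≡⟨ ⟪⟫-cong Q (λ ν → ⟪⟫-cong P (λ μ → δₘ-sym weight μ ν)) ⟩
    ⟪ Q ∣ (λ ν → ⟪ P ∣ (λ μ → weight ν * δₘ μ ν) ⟫) ⟫
      ≡⟨ sym (⟨⟩-double Q P) ⟩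
    ⟨ Q , P ⟩ ∎
    where open ≡-Reasoning

  ⟨⟩-congʳ : ∀ P {Q Q′} → Q ≈ Q′ → ⟨ P , Q ⟩ ≡ ⟨ P , Q′ ⟩
  ⟨⟩-congʳ P Q≈Q′ = apply-congʳ P Q≈Q′ mono0

  ⟨⟩-++ˡ : ∀ A B Q → ⟨ A ++ B , Q ⟩ ≡ ⟨ A , Q ⟩ + ⟨ B , Q ⟩
  ⟨⟩-++ˡ A B Q = trans (apply-++ˡ A B Q mono0) (coeff-++ (apply A Q) (apply B Q) mono0)

  ⟨⟩-·ₚˡ : ∀ a A Q → ⟨ a ·ₚ A , Q ⟩ ≡ a * ⟨ A , Q ⟩
  ⟨⟩-·ₚˡ a A Q = trans (apply-·ₚˡ a A Q mono0) (coeff-·ₚ a (apply A Q) mono0)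

  ⟨⟩-++ʳ : ∀ P A B → ⟨ P , A ++ B ⟩ ≡ ⟨ P , A ⟩ + ⟨ P , B ⟩
  ⟨⟩-++ʳ P A B = trans (⟨⟩-sym P (A ++ B))
    (trans (⟨⟩-++ˡ A B P) (cong₂ _+_ (⟨⟩-sym A P) (⟨⟩-sym B P)))

  ⟨⟩-·ₚʳ : ∀ P a A → ⟨ P , a ·ₚ A ⟩ ≡ a * ⟨ P , A ⟩
  ⟨⟩-·ₚʳ P a A = trans (⟨⟩-sym P (a ·ₚ A)) (trans (⟨⟩-·ₚˡ a A P) (cong (a *_) (⟨⟩-sym A P)))

  ⟨⟩-0ʳ : ∀ P → ⟨ P , 0ₚ ⟩ ≡ 0ℚ
  ⟨⟩-0ʳ P = ⟨⟩-sym P 0ₚ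

  ⟨⟩--ₚˡ : ∀ P A Q → ⟨ P -ₚ A , Q ⟩ ≡ ⟨ P , Q ⟩ - ⟨ A , Q ⟩
  ⟨⟩--ₚˡ P A Q = trans (⟨⟩-++ˡ P ((- 1ℚ) ·ₚ A) Q) (cong (⟨ P , Q ⟩ +_)
    (trans (⟨⟩-·ₚˡ (- 1ℚ) A Q) (-1*x≈-x ⟨ A , Q ⟩)))

  ⟨⟩-pos : ∀ P → ⟨ P , P ⟩ ≡ 0ℚ → P ≈ 0ₚ
  ⟨⟩-pos P PP≡0 x = begin
    coeff P x
      ≡⟨ coeff-as-⟪⟫ P x ⟩
    ⟪ P ∣ (λ ν → δₘ ν x) ⟫
      ≡⟨ ⟪⟫-via-normalise P (λ ν → δₘ ν x) ⟩
    ∑ N (λ t → coeff P (proj₂ t) * δₘ (proj₂ t) x)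
      ≡⟨ ∑-zero N (All.map (λ {t} → vanish t) coeffs≡0) ⟩
    0ℚ ∎
    where
    open ≡-Reasoning
    N = normalise P
    term : ℚ × Mono n → ℚ
    term t = coeff P (proj₂ t) * (weight (proj₂ t) * coeff P (proj₂ t))
    ∑term≡0 : ∑ N term ≡ 0ℚ
    ∑term≡0 = trans (sym (⟪⟫-via-normalise P (λ μ → weight μ * coeff P μ)))
      (trans (sym (⟨⟩-formula P P)) PP≡0)
    coeffs≡0 : All (λ t → coeff P (proj₂ t) ≡ 0ℚ) N
    coeffs≡0 = All.map (λ {t} → weighted-square-≡0 (weight (proj₂ t)) _ {{weight-pos (proj₂ t)}})
      (∑-nonNeg-≡0 N term (All.tabulate (λ {t} _ → term-nonNeg t)) ∑term≡0)
      where
      term-nonNeg : ∀ t → 0ℚ ℚ.≤ term t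
      term-nonNeg t = weighted-square-nonNeg (weight (proj₂ t)) (coeff P (proj₂ t)) {{weight-pos (proj₂ t)}}
    vanish : ∀ t → coeff P (proj₂ t) ≡ 0ℚ → coeff P (proj₂ t) * δₘ (proj₂ t) x ≡ 0ℚ
    vanish t c≡0 = trans (cong (_* δₘ (proj₂ t) x) c≡0) (ℚP.*-zeroˡ (δₘ (proj₂ t) x))

  -- Orthogonal projection

  data Span (ws : List (Poly n)) : Poly n → Set where
    span-0 : Span ws 0ₚ
    span-∈ : ∀ {u} → u ∈ ws → Span ws u
    span-+ : ∀ {A B} → Span ws A → Span ws B → Span ws (A +ₚ B)
    span-· : ∀ c {A} → Span ws A → Span ws (c ·ₚ A)

  span-∷ : ∀ {ws u A} → Span ws A → Span (u ∷ ws) A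
  span-∷ span-0         = span-0
  span-∷ (span-∈ u∈)    = span-∈ (there u∈)
  span-∷ (span-+ sA sB) = span-+ (span-∷ sA) (span-∷ sB)
  span-∷ (span-· c sA)  = span-· c (span-∷ sA)

  ⊥-span : ∀ {ws} r → (∀ u → u ∈ ws → ⟨ r , u ⟩ ≡ 0ℚ) → ∀ {A} → Span ws A → ⟨ r , A ⟩ ≡ 0ℚ
  ⊥-span r r⊥ span-0                  = ⟨⟩-0ʳ r
  ⊥-span r r⊥ (span-∈ u∈)             = r⊥ _ u∈
  ⊥-span r r⊥ (span-+ {A} {B} sA sB)  = trans (⟨⟩-++ʳ r A B)
    (trans (cong₂ _+_ (⊥-span r r⊥ sA) (⊥-span r r⊥ sB)) (ℚP.+-identityˡ 0ℚ))
  ⊥-span r r⊥ (span-· c {A} sA)       = trans (⟨⟩-·ₚʳ r c A)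
    (trans (cong (c *_) (⊥-span r r⊥ sA)) (ℚP.*-zeroʳ c))

  -- Gram–Schmidt: u = u₀ −ₚ b is the part of u₀ orthogonal to ws; when it is
  -- nonzero, the projection of P gains the component of P −ₚ a along u.
  project : ∀ ws P → ∃ λ a → Span ws a × (∀ u → u ∈ ws → ⟨ P -ₚ a , u ⟩ ≡ 0ℚ)
  project []        P = 0ₚ , span-0 , λ _ ()
  project (u₀ ∷ ws) P with project ws u₀ | project ws P
  ... | b , b∈ , u⊥ | a , a∈ , r⊥ = extend (⟨ u , u ⟩ ℚ.≟ 0ℚ)
    where
    u = u₀ -ₚ b
    r = P -ₚ a

    ⊥-u₀ : ∀ s → (∀ w → w ∈ ws → ⟨ s , w ⟩ ≡ 0ℚ) → ⟨ s , u ⟩ ≡ 0ℚ → ⟨ s , u₀ ⟩ ≡ 0ℚ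
    ⊥-u₀ s s⊥ s⊥u = begin
      ⟨ s , u₀ ⟩               ≡⟨ ⟨⟩-congʳ s (≈-+ₚ--ₚ u₀ b) ⟩
      ⟨ s , b +ₚ u ⟩           ≡⟨ ⟨⟩-++ʳ s b u ⟩
      ⟨ s , b ⟩ + ⟨ s , u ⟩    ≡⟨ cong₂ _+_ (⊥-span s s⊥ b∈) s⊥u ⟩
      0ℚ + 0ℚ                  ≡⟨ ℚP.+-identityˡ 0ℚ ⟩
      0ℚ                       ∎
      where open ≡-Reasoning

    u∈ : Span (u₀ ∷ ws) u
    u∈ = span-+ (span-∈ (here refl)) (span-· (- 1ℚ) (span-∷ b∈))

    extend : Dec (⟨ u , u ⟩ ≡ 0ℚ) →
             ∃ λ a′ → Span (u₀ ∷ ws) a′ × (∀ w → w ∈ u₀ ∷ ws → ⟨ P -ₚ a′ , w ⟩ ≡ 0ℚ)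
    extend (yes uu≡0) = a , span-∷ a∈ , orth
      where
      orth : ∀ w → w ∈ u₀ ∷ ws → ⟨ r , w ⟩ ≡ 0ℚ
      orth w (here refl) = ⊥-u₀ r r⊥ (trans (⟨⟩-congʳ r (⟨⟩-pos u uu≡0)) (⟨⟩-0ʳ r))
      orth w (there w∈)  = r⊥ w w∈
    extend (no uu≢0) = a +ₚ (t ·ₚ u) , span-+ (span-∷ a∈) (span-· t u∈) , orth
      where
      instance
        uu-nonZero : ℚ.NonZero ⟨ u , u ⟩
        uu-nonZero = ℚ.≢-nonZero uu≢0
      t = ⟨ r , u ⟩ * ℚ.1/ ⟨ u , u ⟩

      residual : ∀ w → ⟨ P -ₚ (a +ₚ (t ·ₚ u)) , w ⟩ ≡ ⟨ r , w ⟩ - t * ⟨ u , w ⟩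
      residual w = begin
        ⟨ P -ₚ (a +ₚ (t ·ₚ u)) , w ⟩
          ≡⟨ ⟨⟩--ₚˡ P (a +ₚ (t ·ₚ u)) w ⟩
        ⟨ P , w ⟩ - ⟨ a +ₚ (t ·ₚ u) , w ⟩
          ≡⟨ cong (λ x → ⟨ P , w ⟩ - x) (trans (⟨⟩-++ˡ a (t ·ₚ u) w) (cong (⟨ a , w ⟩ +_) (⟨⟩-·ₚˡ t u w))) ⟩
        ⟨ P , w ⟩ - (⟨ a , w ⟩ + t * ⟨ u , w ⟩)
          ≡⟨ solve 4 (λ p a t x → p :- (a :+ t :* x) := (p :- a) :- t :* x) refl ⟨ P , w ⟩ ⟨ a , w ⟩ t ⟨ u , w ⟩ ⟩
        ⟨ P , w ⟩ - ⟨ a , w ⟩ - t * ⟨ u , w ⟩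
          ≡⟨ cong (λ x → x - t * ⟨ u , w ⟩) (sym (⟨⟩--ₚˡ P a w)) ⟩
        ⟨ r , w ⟩ - t * ⟨ u , w ⟩ ∎
        where open ≡-Reasoning

      orth-ws : ∀ w → w ∈ ws → ⟨ P -ₚ (a +ₚ (t ·ₚ u)) , w ⟩ ≡ 0ℚ
      orth-ws w w∈ = trans (residual w) (trans (cong₂ (λ x y → x - t * y) (r⊥ w w∈) (u⊥ w w∈))
        (solve 1 (λ t → con 0ℚ :- t :* con 0ℚ := con 0ℚ) refl t))

      orth-u : ⟨ P -ₚ (a +ₚ (t ·ₚ u)) , u ⟩ ≡ 0ℚ
      orth-u = trans (residual u) (begin
        ⟨ r , u ⟩ - ⟨ r , u ⟩ * ℚ.1/ ⟨ u , u ⟩ * ⟨ u , u ⟩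
          ≡⟨ cong (λ x → ⟨ r , u ⟩ - x) (ℚP.*-assoc ⟨ r , u ⟩ _ _) ⟩
        ⟨ r , u ⟩ - ⟨ r , u ⟩ * (ℚ.1/ ⟨ u , u ⟩ * ⟨ u , u ⟩)
          ≡⟨ cong (λ x → ⟨ r , u ⟩ - ⟨ r , u ⟩ * x) (ℚP.*-inverseˡ ⟨ u , u ⟩) ⟩
        ⟨ r , u ⟩ - ⟨ r , u ⟩ * 1ℚ
          ≡⟨ solve 1 (λ x → x :- x :* con 1ℚ := con 0ℚ) refl ⟨ r , u ⟩ ⟩
        0ℚ ∎)
        where open ≡-Reasoning

      orth : ∀ w → w ∈ u₀ ∷ ws → ⟨ P -ₚ (a +ₚ (t ·ₚ u)) , w ⟩ ≡ 0ℚ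
      orth w (here refl) = ⊥-u₀ (P -ₚ (a +ₚ (t ·ₚ u))) orth-ws orth-u
      orth w (there w∈)  = orth-ws w w∈

  -- Spaces of derivatives

  divisorsᵥ : ∀ {k} → Vec ℕ k → List (Vec ℕ k)
  divisorsᵥ []      = [] ∷ []
  divisorsᵥ (a ∷ v) = List.cartesianProductWith _∷_ (List.upTo (suc a)) (divisorsᵥ v)

  ≤ᵥ⇒∈divisorsᵥ : ∀ {k} {μ δ : Vec ℕ k} → Pointwise ℕ._≤_ μ δ → μ ∈ divisorsᵥ δ
  ≤ᵥ⇒∈divisorsᵥ []          = here refl
  ≤ᵥ⇒∈divisorsᵥ (b≤a ∷ μ≤δ) = ∈-cartesianProductWith⁺ _∷_ (∈-upTo⁺ (s≤s b≤a)) (≤ᵥ⇒∈divisorsᵥ μ≤δ)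

  divisors : Mono n → List (Mono n)
  divisors (a , b) = List.cartesianProduct (divisorsᵥ a) (divisorsᵥ b)

  ∣ₘ⇒∈divisors : ∀ {μ δ} → μ ∣ₘ δ → μ ∈ divisors δ
  ∣ₘ⇒∈divisors (p , q) = ∈-cartesianProduct⁺ (≤ᵥ⇒∈divisorsᵥ p) (≤ᵥ⇒∈divisorsᵥ q)

  supportDivisors : Poly n → List (Mono n)
  supportDivisors F = concatMap (λ t → divisors (proj₂ t)) F

  ∈supportDivisors⊎∂≈0 : ∀ F μ → μ ∈ supportDivisors F ⊎ ∂mono μ F ≈ 0ₚ
  ∈supportDivisors⊎∂≈0 []            μ = inj₂ (λ _ → refl)
  ∈supportDivisors⊎∂≈0 ((d , δ) ∷ F) μ with ∣ₘ-or-fallₘ≡0 δ μ | ∈supportDivisors⊎∂≈0 F μ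
  ... | inj₁ μ∣δ | _         = inj₁ (∈-++⁺ˡ (∣ₘ⇒∈divisors μ∣δ))
  ... | inj₂ _   | inj₁ μ∈   = inj₁ (∈-++⁺ʳ (divisors δ) μ∈)
  ... | inj₂ z   | inj₂ ∂F≈0 = inj₂ λ x → begin
    coeff (∂mono μ ((d , δ) ∷ F)) x
      ≡⟨ coeff-∷ (d * toℚ (fallₘ δ μ)) (δ ⊖ μ) (∂mono μ F) x ⟩
    d * toℚ (fallₘ δ μ) * δₘ (δ ⊖ μ) x + coeff (∂mono μ F) x
      ≡⟨ cong₂ (λ k y → d * toℚ k * δₘ (δ ⊖ μ) x + y) z (∂F≈0 x) ⟩
    d * 0ℚ * δₘ (δ ⊖ μ) x + 0ℚ
      ≡⟨ solve 2 (λ d y → d :* con 0ℚ :* y :+ con 0ℚ := con 0ℚ) refl d (δₘ (δ ⊖ μ) x) ⟩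
    0ℚ ∎
    where open ≡-Reasoning

  M-≈ : ∀ (F : Poly n) {P Q} → P ≈ Q → M F Q → M F P
  M-≈ F P≈Q (cs , Q≈) = cs , λ x → trans (P≈Q x) (Q≈ x)

  apply∈M : ∀ (F R : Poly n) → M F (apply R F)
  apply∈M F R = R , λ _ → refl

  monomial : Mono n → Poly n
  monomial μ = (1ℚ , μ) ∷ []

  apply-monomial : ∀ μ G → apply (monomial μ) G ≈ ∂mono μ G
  apply-monomial μ G x = begin
    coeff (1ℚ ·ₚ ∂mono μ G ++ []) x
      ≡⟨ coeff-++ (1ℚ ·ₚ ∂mono μ G) [] x ⟩
    coeff (1ℚ ·ₚ ∂mono μ G) x + 0ℚ
      ≡⟨ cong (_+ 0ℚ) (coeff-·ₚ 1ℚ (∂mono μ G) x) ⟩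
    1ℚ * coeff (∂mono μ G) x + 0ℚ
      ≡⟨ solve 1 (λ y → con 1ℚ :* y :+ con 0ℚ := y) refl (coeff (∂mono μ G) x) ⟩
    coeff (∂mono μ G) x ∎
    where open ≡-Reasoning

  ∂∈M : ∀ (F : Poly n) μ → M F (∂mono μ F)
  ∂∈M F μ = M-≈ F {∂mono μ F} {apply (monomial μ) F}
    (λ x → sym (apply-monomial μ F x)) (apply∈M F (monomial μ))

  M-apply-closed : ∀ (F R : Poly n) {Q} → M F Q → M F (apply R Q)
  M-apply-closed F R {Q} (cs , Q≈) = R *ₚ cs , λ x →
    trans (apply-congʳ R {Q} {apply cs F} Q≈ x) (sym (apply-*ₚ R cs F x))

  M-+ₚ : ∀ (F : Poly n) {P Q} → M F P → M F Q → M F (P +ₚ Q)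
  M-+ₚ F {P} {Q} (cs , P≈) (ds , Q≈) = cs ++ ds , λ x → begin
    coeff (P +ₚ Q) x                                ≡⟨ coeff-++ P Q x ⟩
    coeff P x + coeff Q x                           ≡⟨ cong₂ _+_ (P≈ x) (Q≈ x) ⟩
    coeff (apply cs F) x + coeff (apply ds F) x     ≡⟨ sym (coeff-++ (apply cs F) (apply ds F) x) ⟩
    coeff (apply cs F ++ apply ds F) x              ≡⟨ sym (apply-++ˡ cs ds F x) ⟩
    coeff (apply (cs ++ ds) F) x                    ∎
    where open ≡-Reasoning

  M-·ₚ : ∀ (F : Poly n) c {P} → M F P → M F (c ·ₚ P)
  M-·ₚ F c {P} (cs , P≈) = c ·ₚ cs , λ x → begin
    coeff (c ·ₚ P) x              ≡⟨ coeff-·ₚ c P x ⟩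
    c * coeff P x                 ≡⟨ cong (c *_) (P≈ x) ⟩
    c * coeff (apply cs F) x      ≡⟨ sym (coeff-·ₚ c (apply cs F) x) ⟩
    coeff (c ·ₚ apply cs F) x     ≡⟨ sym (apply-·ₚˡ c cs F x) ⟩
    coeff (apply (c ·ₚ cs) F) x   ∎
    where open ≡-Reasoning

  M--ₚ : ∀ (F : Poly n) {P Q} → M F P → M F Q → M F (P -ₚ Q)
  M--ₚ F {P} {Q} P∈ Q∈ = M-+ₚ F {P} {(- 1ℚ) ·ₚ Q} P∈ (M-·ₚ F (- 1ℚ) {Q} Q∈)

  M-trans : ∀ {F G : Poly n} → M F G → M G ⊆ M F
  M-trans {F} {G} G∈ Q (cs , Q≈) = M-≈ F {Q} {apply cs G} Q≈ (M-apply-closed F cs G∈)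

  ⊥-∂⇒⊥M : ∀ (F r : Poly n) → (∀ μ → ⟨ r , ∂mono μ F ⟩ ≡ 0ℚ) → (M F ⊥) r
  ⊥-∂⇒⊥M F r r⊥ Q (cs , Q≈) = trans (⟨⟩-congʳ r Q≈) (⊥-apply cs)
    where
    ⊥-apply : ∀ cs → ⟨ r , apply cs F ⟩ ≡ 0ℚ
    ⊥-apply []            = ⟨⟩-0ʳ r
    ⊥-apply ((c , μ) ∷ cs) = begin
      ⟨ r , c ·ₚ ∂mono μ F ++ apply cs F ⟩
        ≡⟨ ⟨⟩-++ʳ r (c ·ₚ ∂mono μ F) (apply cs F) ⟩
      ⟨ r , c ·ₚ ∂mono μ F ⟩ + ⟨ r , apply cs F ⟩
        ≡⟨ cong₂ _+_ (⟨⟩-·ₚʳ r c (∂mono μ F)) (⊥-apply cs) ⟩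
      c * ⟨ r , ∂mono μ F ⟩ + 0ℚ
        ≡⟨ cong (λ y → c * y + 0ℚ) (r⊥ μ) ⟩
      c * 0ℚ + 0ℚ
        ≡⟨ solve 1 (λ c → c :* con 0ℚ :+ con 0ℚ := con 0ℚ) refl c ⟩
      0ℚ ∎
      where open ≡-Reasoning

  project-M : ∀ (F P : Poly n) → ∃ λ a → M F a × (M F ⊥) (P -ₚ a)
  project-M F P with project (map (λ μ → ∂mono μ F) (supportDivisors F)) P
  ... | a , a∈ , r⊥ = a , span⇒M a∈ , ⊥-∂⇒⊥M F (P -ₚ a) ⊥∂
    where
    span⇒M : ∀ {A} → Span (map (λ μ → ∂mono μ F) (supportDivisors F)) A → M F A
    span⇒M span-0         = [] , λ _ → refl
    span⇒M (span-∈ u∈) with ∈-map⁻ (λ μ → ∂mono μ F) u∈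
    ... | μ , _ , refl    = ∂∈M F μ
    span⇒M (span-+ {A} {B} sA sB) = M-+ₚ F {A} {B} (span⇒M sA) (span⇒M sB)
    span⇒M (span-· c {A} sA)      = M-·ₚ F c {A} (span⇒M sA)
    ⊥∂ : ∀ μ → ⟨ P -ₚ a , ∂mono μ F ⟩ ≡ 0ℚ
    ⊥∂ μ with ∈supportDivisors⊎∂≈0 F μ
    ... | inj₁ μ∈  = r⊥ _ (∈-map⁺ (λ ν → ∂mono ν F) μ∈)
    ... | inj₂ ∂≈0 = trans (⟨⟩-congʳ (P -ₚ a) ∂≈0) (⟨⟩-0ʳ (P -ₚ a))

  -- The decompositions

  ⟨⟩-monomialˡ : ∀ μ Z → ⟨ monomial μ , Z ⟩ ≡ weight μ * coeff Z μ
  ⟨⟩-monomialˡ μ Z = trans (⟨⟩-formula (monomial μ) Z)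
    (solve 1 (λ y → con 1ℚ :* y :+ con 0ℚ := y) refl (weight μ * coeff Z μ))

  ⟨⟩-apply-swap : ∀ P Q F → ⟨ P , apply Q F ⟩ ≡ ⟨ Q , apply P F ⟩
  ⟨⟩-apply-swap P Q F = apply-comm P Q F mono0

  weight*coeff≡⟨,∂⟩ : ∀ D P F μ →
    weight μ * coeff (apply D (apply P F)) μ ≡ ⟨ P , ∂mono μ (apply D F) ⟩
  weight*coeff≡⟨,∂⟩ D P F μ = begin
    weight μ * coeff (apply D (apply P F)) μ
      ≡⟨ sym (⟨⟩-monomialˡ μ (apply D (apply P F))) ⟩
    ⟨ e , apply D (apply P F) ⟩
      ≡⟨ ⟨⟩-congʳ e {apply D (apply P F)} {apply P (apply D F)} (apply-comm D P F) ⟩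
    ⟨ e , apply P (apply D F) ⟩
      ≡⟨ ⟨⟩-apply-swap e P (apply D F) ⟩
    ⟨ P , apply e (apply D F) ⟩
      ≡⟨ ⟨⟩-congʳ P {apply e (apply D F)} {∂mono μ (apply D F)} (apply-monomial μ (apply D F)) ⟩
    ⟨ P , ∂mono μ (apply D F) ⟩ ∎
    where
    open ≡-Reasoning
    e = monomial μ

  ⊥M-apply⇒annihilates : ∀ D F P → (M (apply D F) ⊥) P → apply D (apply P F) ≈ 0ₚ
  ⊥M-apply⇒annihilates D F P P⊥ μ =
    *-cancelˡ-≡0 (weight μ) _ {{ℚP.pos⇒nonZero (weight μ) {{weight-pos μ}}}}
      (trans (weight*coeff≡⟨,∂⟩ D P F μ) (P⊥ _ (∂∈M (apply D F) μ)))

  annihilates⇒⊥M-apply : ∀ D F P → apply D (apply P F) ≈ 0ₚ → (M (apply D F) ⊥) P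
  annihilates⇒⊥M-apply D F P DPF≈0 = ⊥-∂⇒⊥M (apply D F) P (λ μ →
    trans (sym (weight*coeff≡⟨,∂⟩ D P F μ))
      (trans (cong (weight μ *_) (DPF≈0 μ)) (ℚP.*-zeroʳ (weight μ))))

  Ker : Poly n → Poly n → Subspace
  Ker F D Q = M F Q × (apply D Q ≈ 0ₚ)

  M-apply-⊆ : ∀ F D → M (apply D F) ⊆ M F
  M-apply-⊆ F D = M-trans (apply∈M F D)

  M-apply-image : ∀ F D Q → M F Q → M (apply D F) (apply D Q)
  M-apply-image F D Q (cs , Q≈) = cs , λ x →
    trans (apply-congʳ D {Q} {apply cs F} Q≈ x) (apply-comm D cs F x)

  M-apply-surjective : ∀ F D R → M (apply D F) R → ∃ λ Q → M F Q × (apply D Q ≈ R)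
  M-apply-surjective F D R (cs , R≈) =
    apply cs F , apply∈M F cs , λ x → trans (apply-comm D cs F x) (sym (R≈ x))

  M∩⊥≐flipPreimage : ∀ F D → (M F ∩ (M (apply D F) ⊥)) ≐ flipPreimage F (Ker F D)
  M∩⊥≐flipPreimage F D =
    (λ P (P∈ , P⊥) → P∈ , apply∈M F P , ⊥M-apply⇒annihilates D F P P⊥) ,
    (λ P (P∈ , _ , DPF≈0) → P∈ , annihilates⇒⊥M-apply D F P DPF≈0)

  M-orthDirectSum : ∀ F D → IsOrthDirectSum (M F) (M (apply D F)) (flipPreimage F (Ker F D))
  M-orthDirectSum F D = (M-apply-⊆ F D , (λ _ → proj₁) , split , trivial) , orthogonal
    where
    split : ∀ P → M F P → ∃ λ a → ∃ λ b → M (apply D F) a × flipPreimage F (Ker F D) b × (P ≈ a +ₚ b)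
    split P P∈ with project-M (apply D F) P
    ... | a , a∈ , P-a⊥ = a , P -ₚ a , a∈ ,
      (M--ₚ F {P} {a} P∈ (M-apply-⊆ F D a a∈) , apply∈M F (P -ₚ a) ,
       ⊥M-apply⇒annihilates D F (P -ₚ a) P-a⊥) ,
      ≈-+ₚ--ₚ P a
    trivial : ∀ P → M (apply D F) P → flipPreimage F (Ker F D) P → P ≈ 0ₚ
    trivial P P∈ (_ , _ , DPF≈0) = ⟨⟩-pos P (annihilates⇒⊥M-apply D F P DPF≈0 P P∈)
    orthogonal : Orthogonal (M (apply D F)) (flipPreimage F (Ker F D))
    orthogonal P Q P∈ (_ , _ , DQF≈0) = trans (⟨⟩-sym P Q) (annihilates⇒⊥M-apply D F Q DQF≈0 P P∈)

  flip-directSum : ∀ F D → IsDirectSum (M F) (flipImage F (M (apply D F))) (Ker F D)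
  flip-directSum F D = flipImage⊆M , (λ _ → proj₁) , split , trivial
    where
    flipImage⊆M : flipImage F (M (apply D F)) ⊆ M F
    flipImage⊆M Q (P , _ , Q≈) = M-≈ F {Q} {apply P F} Q≈ (apply∈M F P)
    split : ∀ Q → M F Q → ∃ λ a → ∃ λ b → flipImage F (M (apply D F)) a × Ker F D b × (Q ≈ a +ₚ b)
    split Q (cs , Q≈) with project-M (apply D F) cs
    ... | a , a∈ , cs-a⊥ = apply a F , apply (cs -ₚ a) F , (a , a∈ , λ _ → refl) ,
      (apply∈M F (cs -ₚ a) , ⊥M-apply⇒annihilates D F (cs -ₚ a) cs-a⊥) ,
      λ x → trans (Q≈ x)
              (trans (apply-congˡ {cs} {a +ₚ (cs -ₚ a)} F (≈-+ₚ--ₚ cs a) x) (apply-++ˡ a (cs -ₚ a) F x))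
    trivial : ∀ Q → flipImage F (M (apply D F)) Q → Ker F D Q → Q ≈ 0ₚ
    trivial Q (P , P∈ , Q≈) (_ , DQ≈0) x = trans (Q≈ x) (apply-congˡ {P} {0ₚ} F P≈0 x)
      where
      P≈0 : P ≈ 0ₚ
      P≈0 = ⟨⟩-pos P (annihilates⇒⊥M-apply D F P
        (λ y → trans (apply-congʳ D {apply P F} {Q} (λ z → sym (Q≈ z)) y) (DQ≈0 y)) P P∈)

propositionI7 :
    (n : ℕ) (Δ D : Poly n) → Alternating Δ →
      let Δ̃ = apply D Δ
          K = λ (Q : Poly n) → M Δ Q × (apply D Q ≈ 0ₚ)
      in (M Δ̃ ⊆ M Δ)
         × (∀ Q → M Δ Q → M Δ̃ (apply D Q))
         × (∀ R → M Δ̃ R → ∃ λ Q → M Δ Q × (apply D Q ≈ R))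
         × ((M Δ ∩ (M Δ̃ ⊥)) ≐ flipPreimage Δ K)
         × IsOrthDirectSum (M Δ) (M Δ̃) (flipPreimage Δ K)
         × IsDirectSum (M Δ) (flipImage Δ (M Δ̃)) K
propositionI7 n Δ D _ =
  M-apply-⊆ Δ D , M-apply-image Δ D , M-apply-surjective Δ D ,
  M∩⊥≐flipPreimage Δ D , M-orthDirectSum Δ D , flip-directSum Δ D
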